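{- Let $k,t\ge 2$ be integers and $1\le r\le t$. As formal power series (and for $|q|<1$), \[ \sum_{n\ge 0} D_k^\times(r,t;n)q^n = \frac{(q^k;q^k)_\infty}{(q;q)_\infty}\sum_{\substack{m\ge 1,\ k \nmid m \\ m \equiv r \pmod t}} \frac{q^m}{1 - q^m}, \] and if $\gcd(k,t) = 1$ then \[ \sum_{n\ge 0} D_k^\times(r,t;n)q^n = \frac{(q^k;q^k)_\infty}{(q;q)_\infty}\left(\sum_{\substack{m\ge1\\ m \equiv r \pmod t}} \frac{q^m}{1 - q^m} - \sum_{\substack{m\ge 1\\ m \equiv \bar{r}_{k,t} \pmod t}} \frac{q^{mk}}{1 - q^{mk}}\right), \] where $1 \leq \bar{r}_{k,t} \leq t$ is the representative of $rk^{ -1}$ modulo $t$.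
   Context: A partition of $n$ is $k$-indivisible if none of its parts is divisible by $k$. $D_k^\times(r,t;n)$ denotes the total number of parts congruent to $r$ modulo $t$, counted with multiplicity, over all $k$-indivisible partitions of $n$ (with $D_k^\times(r,t;0)=0$). The $q$-Pochhammer symbol is $(a;q)_\infty \coloneqq \prod_{n \geq 1} (1 - aq^{n-1})$. -}

module Defs where

open import Data.Nat using (ℕ; zero; suc; _+_; _*_; _∸_; _≤?_; _≟_)
open import Data.Nat.DivMod using (_%_)
open import Data.Nat.Divisibility using (_∣?_)
open import Data.Integer as ℤ using (ℤ; +_)
open import Data.Bool using (Bool; true; false; if_then_else_; not; _∧_)
open import Data.List using (List; []; _∷_; map; filter; concatMap; applyUpTo; upTo; length)
open import Data.Nat.ListAction using (sum)
open import Data.Bool.ListAction using () renaming (all to allL)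
open import Relation.Nullary using (does)
open import Relation.Nullary.Decidable using (¬?)

-- m mod t (with the harmless convention m mod 0 = m; only t ≥ 2 is used)
_mod_ : ℕ → ℕ → ℕ
m mod zero    = m
m mod (suc t) = m % suc t

_≡ᵇ_[mod_] : ℕ → ℕ → ℕ → Bool
a ≡ᵇ b [mod t ] = does ((a mod t) ≟ (b mod t))

-- parts fuel n b : all partitions of n (as non-increasing lists of
-- positive integers) whose largest part is ≤ b.  Fuel ≥ n suffices.
parts : ℕ → ℕ → ℕ → List (List ℕ)
parts _        zero    _ = [] ∷ []
parts zero     (suc n) _ = []
parts (suc f)  (suc n) b =
  concatMap (λ p → map (p ∷_) (parts f (suc n ∸ p) p))
            (filter (λ p → p ≤? suc n) (applyUpTo suc b))

partitions : ℕ → List (List ℕ)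
partitions n = parts n n n

indivPart : ℕ → ℕ → Bool
indivPart k p = not (does (k ∣? p))

indivPartitions : ℕ → ℕ → List (List ℕ)
indivPartitions k n = filter (λ λs → Data.Bool._≟_ (allL (indivPart k) λs) true) (partitions n)

countParts : ℕ → ℕ → List ℕ → ℕ
countParts r t λs = length (filter (λ p → Data.Bool._≟_ (p ≡ᵇ r [mod t ]) true) λs)

D× : ℕ → ℕ → ℕ → ℕ → ℕ
D× k r t n = sum (map (countParts r t) (indivPartitions k n))

FPS : Set
FPS = ℕ → ℤ

Σ≤ : ℕ → (ℕ → ℤ) → ℤ
Σ≤ n f = Data.List.foldr ℤ._+_ (+ 0) (map f (upTo (suc n)))

one : FPS
one zero    = + 1
one (suc _) = + 0

mono : ℕ → FPS
mono m n = if does (n ≟ m) then + 1 else + 0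

_⊕_ : FPS → FPS → FPS
(f ⊕ g) n = f n ℤ.+ g n

_⊖_ : FPS → FPS → FPS
(f ⊖ g) n = f n ℤ.- g n

_⊛_ : FPS → FPS → FPS
(f ⊛ g) n = Σ≤ n (λ i → f i ℤ.* g (n ∸ i))

infixl 6 _⊕_ _⊖_
infixl 7 _⊛_

-- Multiplicative inverse of a series with constant term 1:
-- b₀ = 1,  b_{n+1} = - Σ_{i=0}^{n} f_{i+1} b_{n-i}.
-- invUpTo f n is correct on all indices ≤ n.
invUpTo : FPS → ℕ → FPS
invUpTo f zero    _ = + 1
invUpTo f (suc n) m =
  if does (m ≤? n) then invUpTo f n m
  else ℤ.- Σ≤ n (λ i → f (suc i) ℤ.* invUpTo f n (n ∸ i))

inv : FPS → FPS
inv f n = invUpTo f n n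

pochFin : ℕ → ℕ → ℕ → FPS
pochFin a b zero    = one ⊖ mono a
pochFin a b (suc N) = pochFin a b N ⊛ (one ⊖ mono (a + b * suc N))

-- (q^a ; q^b)_∞ = ∏_{j ≥ 0} (1 - q^{a + b j})  (for a, b ≥ 1);
-- its n-th coefficient is that of the truncation at j ≤ n, since
-- the remaining factors are 1 + O(q^{n+1}).
poch : ℕ → ℕ → FPS
poch a b n = pochFin a b n n

lambertTerm : ℕ → FPS
lambertTerm m = mono m ⊛ inv (one ⊖ mono m)

-- Σ_{m ≥ 1, cond m} term m, for families with term m = O(q^m);
-- the n-th coefficient only involves m ≤ n.
sumOver : (ℕ → Bool) → (ℕ → FPS) → FPS
sumOver cond term n = Σ≤ n (λ m → if cond m then (if does (m ≟ 0) then + 0 else term m n) else + 0)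

Dgen : ℕ → ℕ → ℕ → FPS
Dgen k r t n = + D× k r t n

module Submission where

-- Call a part allowed if k does not divide it and marked if it is ≡ r (mod t). Let C_b and
-- W_b be the generating functions of partitions into allowed parts ≤ b, the latter weighting
-- each partition by its number of marked parts. Splitting off the parts equal to m = b + 1
-- gives (1 - q^m) C_m = C_b and (1 - q^m) W_m = W_b + [m marked] q^m C_m when m is allowed,
-- and C_m = C_b, W_m = W_b otherwise. By induction on b,
--   ∏_{m ≤ b} (1 - q^m) · C_b = ∏_{m ≤ b, k ∣ m} (1 - q^m),
--   W_b = C_b · Σ_{m ≤ b, m allowed and marked} q^m / (1 - q^m),
-- and all these series agree with their limits up to q^b, which gives the first identity.
-- For the second, the condition k ∤ m is removed by subtracting the terms with k ∣ m; these
-- are reindexed by m = j k, and j k ≡ r (mod t) iff j ≡ r̄ (mod t) since k is a unit mod t.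

open import Defs
open import Data.Nat using (ℕ; suc)
open import Data.Bool using (Bool; true; false)

module Arithmetic where
  open import Data.Nat using (ℕ; _+_; _*_; _∸_; _≤_; _<_; _<?_; _≟_; NonZero; >-nonZero; suc)
  open import Data.Nat.Properties
  open import Data.Nat.DivMod
  open import Data.Nat.Divisibility using (_∣_; m%n≡0⇒n∣m; ∣m+n∣m⇒∣n; m∣m*n; ∣⇒≤)
  open import Data.Nat.Coprimality using (Coprime; coprime-divisor)
  open import Data.Bool.Properties using (T-≡)
  open import Data.Sum using (inj₁; inj₂)
  open import Function.Bundles using (mk⇔; Equivalence)
  open import Relation.Binary.PropositionalEquality
  open import Relation.Nullary using (¬_; yes; no; contradiction)
  open import Relation.Nullary.Decidable using (does-⇔)

  ¬∣-between : ∀ k M i → 0 < i → i < k → ¬ k ∣ k * M + i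
  ¬∣-between k M i 0<i i<k k∣ = <⇒≱ i<k (∣⇒≤ {{>-nonZero 0<i}} (∣m+n∣m⇒∣n k∣ (m∣m*n M)))

  private
    -- both residues are below o, so their sum wraps around at most once
    residue-cancel : ∀ a b o .{{_ : NonZero o}} → a < o → b < o → (a + b) % o ≡ a → b ≡ 0
    residue-cancel a b o a<o b<o a+b%o≡a with a + b <? o
    ... | yes a+b<o = +-cancelˡ-≡ a b 0 (trans (sym (m<n⇒m%n≡m a+b<o)) (trans a+b%o≡a (sym (+-identityʳ a))))
    ... | no  a+b≮o = contradiction (subst (_< o) b≡o b<o) (<-irrefl refl)
      where
      o≤a+b : o ≤ a + b
      o≤a+b = ≮⇒≥ a+b≮o
      a+b∸o≡a : a + b ∸ o ≡ a
      a+b∸o≡a = trans (sym (m<n⇒m%n≡m (m<n+o⇒m∸n<o (a + b) o (+-mono-< a<o b<o))))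
                      (trans (m≤n⇒[n∸m]%m≡n%m o≤a+b) a+b%o≡a)
      b≡o : b ≡ o
      b≡o = +-cancelˡ-≡ a b o (trans (sym (m∸n+n≡m o≤a+b)) (cong (_+ o) a+b∸o≡a))

  [m+n]%o≡m%o⇒n%o≡0 : ∀ m n o .{{_ : NonZero o}} → (m + n) % o ≡ m % o → n % o ≡ 0
  [m+n]%o≡m%o⇒n%o≡0 m n o eq = residue-cancel (m % o) (n % o) o (m%n<n m o) (m%n<n n o) (trans (sym (%-distribˡ-+ m n o)) eq)

  module _ {t k : ℕ} .{{_ : NonZero t}} (coprime : Coprime t k) where

    private
      *-cancelʳ-≡-mod-≤ : ∀ {a b} → a ≤ b → (b * k) % t ≡ (a * k) % t → b % t ≡ a % t
      *-cancelʳ-≡-mod-≤ {a} {b} a≤b bk≡ak = begin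
        b % t          ≡⟨ cong (_% t) (m+[n∸m]≡n a≤b) ⟨
        (a + d) % t    ≡⟨ %-remove-+ʳ a t∣d ⟩
        a % t          ∎
        where
        open ≡-Reasoning
        d = b ∸ a
        ak+dk≡ak : (a * k + d * k) % t ≡ (a * k) % t
        ak+dk≡ak = trans (cong (_% t) (trans (sym (*-distribʳ-+ k a d)) (cong (_* k) (m+[n∸m]≡n a≤b)))) bk≡ak
        t∣d : t ∣ d
        t∣d = coprime-divisor coprime (subst (t ∣_) (*-comm d k)
                (m%n≡0⇒n∣m (d * k) t ([m+n]%o≡m%o⇒n%o≡0 (a * k) (d * k) t ak+dk≡ak)))

    *-cancelʳ-≡-mod : ∀ i j → (i * k) % t ≡ (j * k) % t → i % t ≡ j % t
    *-cancelʳ-≡-mod i j ik≡jk with ≤-total i j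
    ... | inj₁ i≤j = sym (*-cancelʳ-≡-mod-≤ i≤j (sym ik≡jk))
    ... | inj₂ j≤i = *-cancelʳ-≡-mod-≤ j≤i ik≡jk

  *-congʳ-≡-mod : ∀ {t} k .{{_ : NonZero t}} i j → i % t ≡ j % t → (i * k) % t ≡ (j * k) % t
  *-congʳ-≡-mod {t} k i j i≡j = trans (%-distribˡ-* i k t) (trans (cong (λ x → (x * (k % t)) % t) i≡j) (sym (%-distribˡ-* j k t)))

  ≡ᵇ-mod-*-inverse : ∀ {t-1 k r s} → Coprime (suc t-1) k → ((s * k) ≡ᵇ r [mod suc t-1 ]) ≡ true →
                     ∀ j → ((j * k) ≡ᵇ r [mod suc t-1 ]) ≡ (j ≡ᵇ s [mod suc t-1 ])
  ≡ᵇ-mod-*-inverse {t-1} {k} {r} {s} coprime sk≡ᵇr j =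
    does-⇔ (mk⇔ (λ jk≡r → *-cancelʳ-≡-mod coprime j s (trans jk≡r (sym sk≡r)))
                (λ j≡s → trans (*-congʳ-≡-mod k j s j≡s) sk≡r)) ((j * k) % t ≟ r % t) (j % t ≟ s % t)
    where
    t = suc t-1
    sk≡r : (s * k) % t ≡ r % t
    sk≡r = ≡ᵇ⇒≡ _ _ (Equivalence.from T-≡ sk≡ᵇr)

module PowerSeries where

  open import Data.Nat as ℕ using (ℕ; zero; suc; _∸_; _≤_; _<_; z≤n; s≤s; _≤?_)
  open import Data.Product using (_,_)
  open import Data.Bool using (Bool; true; false; if_then_else_; not; _∧_)
  open import Data.Bool.Properties using (if-eta)
  import Data.Nat.Properties as ℕP
  open import Data.Nat.Divisibility using (_∣_; _∣?_; n∣m*n)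
  open import Relation.Nullary.Decidable using (dec-true; dec-false)
  open Arithmetic using (¬∣-between)
  open import Data.Integer using (ℤ; +_; _+_; _*_; -_; _-_; -1ℤ)
  import Data.Integer.Properties as ℤP
  open import Data.Integer.Tactic.RingSolver using (solve-∀)
  open import Data.List using (List; []; _∷_; map; upTo; foldr; _++_; [_])
  import Data.List.Properties as LP
  open import Function using (_∘_)
  open import Algebra.Bundles using (CommutativeMonoid)
  open import Relation.Binary.Bundles using (Setoid)
  import Relation.Binary.Reasoning.Setoid
  open import Relation.Binary.PropositionalEquality hiding ([_])
  open import Relation.Nullary using (¬_; yes; no; does; contradiction)

  infix 4 _≐_ _≈[_]_

  _≐_ : FPS → FPS → Set
  f ≐ g = ∀ n → f n ≡ g n

  _≈[_]_ : FPS → ℕ → FPS → Set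
  f ≈[ n ] g = ∀ i → i ≤ n → f i ≡ g i

  ≐-setoid : Setoid _ _
  ≐-setoid = record
    { Carrier       = FPS
    ; _≈_           = _≐_
    ; isEquivalence = record
      { refl  = λ _ → refl
      ; sym   = λ f≐g n → sym (f≐g n)
      ; trans = λ f≐g g≐h n → trans (f≐g n) (g≐h n)
      }
    }

  open Setoid ≐-setoid public using () renaming (refl to ≐-refl; reflexive to ≐-reflexive; sym to ≐-sym; trans to ≐-trans)

  module ≐-Reasoning = Relation.Binary.Reasoning.Setoid ≐-setoid

  ≐⇒≈ : ∀ {f g} n → f ≐ g → f ≈[ n ] g
  ≐⇒≈ n f≐g i _ = f≐g i

  ≈-≤ : ∀ {f g m n} → m ≤ n → f ≈[ n ] g → f ≈[ m ] g
  ≈-≤ m≤n f≈g i i≤m = f≈g i (ℕP.≤-trans i≤m m≤n)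

  shift : FPS → FPS
  shift f i = f (suc i)

  𝟘 : FPS
  𝟘 _ = + 0

  infixr 8 _·ˢ_
  _·ˢ_ : ℤ → FPS → FPS
  (c ·ˢ f) n = c * f n

  ⊕-cong : ∀ {f f' g g'} → f ≐ f' → g ≐ g' → f ⊕ g ≐ f' ⊕ g'
  ⊕-cong f≐f' g≐g' n = cong₂ _+_ (f≐f' n) (g≐g' n)

  Σ≤-suc : ∀ n f → Σ≤ (suc n) f ≡ f 0 + Σ≤ n (f ∘ suc)
  Σ≤-suc n f = cong (λ l → f 0 + foldr _+_ (+ 0) l)
    (trans (LP.map-applyUpTo suc f (suc n)) (sym (LP.map-upTo (f ∘ suc) (suc n))))

  private
    foldr-+-init : ∀ (xs : List ℤ) a → foldr _+_ a xs ≡ foldr _+_ (+ 0) xs + a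
    foldr-+-init []       a = sym (ℤP.+-identityˡ a)
    foldr-+-init (x ∷ xs) a = trans (cong (λ z → x + z) (foldr-+-init xs a)) (sym (ℤP.+-assoc x _ a))

  Σ≤-snoc : ∀ n f → Σ≤ (suc n) f ≡ Σ≤ n f + f (suc n)
  Σ≤-snoc n f = begin
    foldr _+_ (+ 0) (map f (upTo (suc (suc n))))              ≡⟨ cong (foldr _+_ (+ 0) ∘ map f) (LP.upTo-∷ʳ (suc n)) ⟨
    foldr _+_ (+ 0) (map f (upTo (suc n) ++ [ suc n ]))       ≡⟨ cong (foldr _+_ (+ 0)) (LP.map-++ f (upTo (suc n)) [ suc n ]) ⟩
    foldr _+_ (+ 0) (map f (upTo (suc n)) ++ [ f (suc n) ])   ≡⟨ LP.foldr-++ _+_ (+ 0) (map f (upTo (suc n))) [ f (suc n) ] ⟩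
    foldr _+_ (f (suc n) + + 0) (map f (upTo (suc n)))        ≡⟨ foldr-+-init (map f (upTo (suc n))) _ ⟩
    Σ≤ n f + (f (suc n) + + 0)                                ≡⟨ cong (λ z → Σ≤ n f + z) (ℤP.+-identityʳ _) ⟩
    Σ≤ n f + f (suc n)                                        ∎
    where open ≡-Reasoning

  Σ≤-cong : ∀ n {f g} → (∀ m → f m ≡ g m) → Σ≤ n f ≡ Σ≤ n g
  Σ≤-cong n f≗g = cong (foldr _+_ (+ 0)) (LP.map-cong f≗g (upTo (suc n)))

  Σ≤-⊖ : ∀ n f g → Σ≤ n (f ⊖ g) ≡ Σ≤ n f - Σ≤ n g
  Σ≤-⊖ zero f g = rearrange (f 0) (g 0)
    where
    rearrange : ∀ a b → a - b + + 0 ≡ (a + + 0) - (b + + 0)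
    rearrange = solve-∀
  Σ≤-⊖ (suc n) f g = begin
    Σ≤ (suc n) (f ⊖ g)                               ≡⟨ Σ≤-snoc n (f ⊖ g) ⟩
    Σ≤ n (f ⊖ g) + (f (suc n) - g (suc n))           ≡⟨ cong (_+ (f (suc n) - g (suc n))) (Σ≤-⊖ n f g) ⟩
    Σ≤ n f - Σ≤ n g + (f (suc n) - g (suc n))        ≡⟨ rearrange (Σ≤ n f) (Σ≤ n g) (f (suc n)) (g (suc n)) ⟩
    (Σ≤ n f + f (suc n)) - (Σ≤ n g + g (suc n))      ≡⟨ cong₂ _-_ (Σ≤-snoc n f) (Σ≤-snoc n g) ⟨
    Σ≤ (suc n) f - Σ≤ (suc n) g                      ∎
    where
    open ≡-Reasoning
    rearrange : ∀ a b c d → a - b + (c - d) ≡ (a + c) - (b + d)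
    rearrange = solve-∀

  ⊛-suc : ∀ f g n → (f ⊛ g) (suc n) ≡ f 0 * g (suc n) + (shift f ⊛ g) n
  ⊛-suc f g n = Σ≤-suc n (λ i → f i * g (suc n ∸ i))

  ⊛-coeff-cong : ∀ n {f f' g g'} → f ≈[ n ] f' → g ≈[ n ] g' → (f ⊛ g) n ≡ (f' ⊛ g') n
  ⊛-coeff-cong zero    f≈f' g≈g' = cong (_+ + 0) (cong₂ _*_ (f≈f' 0 z≤n) (g≈g' 0 z≤n))
  ⊛-coeff-cong (suc n) {f} {f'} {g} {g'} f≈f' g≈g' = begin
    (f ⊛ g) (suc n)                       ≡⟨ ⊛-suc f g n ⟩
    f 0 * g (suc n) + (shift f ⊛ g) n     ≡⟨ cong₂ _+_ (cong₂ _*_ (f≈f' 0 z≤n) (g≈g' (suc n) ℕP.≤-refl))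
                                                     (⊛-coeff-cong n (λ i i≤n → f≈f' (suc i) (s≤s i≤n))
                                                                 (λ i i≤n → g≈g' i (ℕP.m≤n⇒m≤1+n i≤n))) ⟩
    f' 0 * g' (suc n) + (shift f' ⊛ g') n ≡⟨ ⊛-suc f' g' n ⟨
    (f' ⊛ g') (suc n)                     ∎
    where open ≡-Reasoning

  ⊛-cong : ∀ {f f' g g'} → f ≐ f' → g ≐ g' → f ⊛ g ≐ f' ⊛ g'
  ⊛-cong f≐f' g≐g' n = ⊛-coeff-cong n (≐⇒≈ n f≐f') (≐⇒≈ n g≐g')

  ⊛-cong-≈ : ∀ {n f f' g g'} → f ≈[ n ] f' → g ≈[ n ] g' → f ⊛ g ≈[ n ] f' ⊛ g'
  ⊛-cong-≈ f≈f' g≈g' i i≤n = ⊛-coeff-cong i (≈-≤ i≤n f≈f') (≈-≤ i≤n g≈g')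

  ⊛-congˡ : ∀ f {g g'} → g ≐ g' → f ⊛ g ≐ f ⊛ g'
  ⊛-congˡ f = ⊛-cong (≐-refl {f})

  ⊛-congʳ : ∀ g {f f'} → f ≐ f' → f ⊛ g ≐ f' ⊛ g
  ⊛-congʳ g f≐f' = ⊛-cong f≐f' (≐-refl {g})

  ⊛-comm : ∀ f g → f ⊛ g ≐ g ⊛ f
  ⊛-comm f g zero = swap (f 0) (g 0)
    where
    swap : ∀ a b → a * b + + 0 ≡ b * a + + 0
    swap = solve-∀
  ⊛-comm f g (suc zero) = begin
    (f ⊛ g) 1                     ≡⟨ ⊛-suc f g 0 ⟩
    f 0 * g 1 + (f 1 * g 0 + + 0) ≡⟨ swap (f 0) (g 1) (f 1) (g 0) ⟩
    g 0 * f 1 + (g 1 * f 0 + + 0) ≡⟨ ⊛-suc g f 0 ⟨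
    (g ⊛ f) 1                     ∎
    where
    open ≡-Reasoning
    swap : ∀ a b c d → a * b + (c * d + + 0) ≡ d * c + (b * a + + 0)
    swap = solve-∀
  ⊛-comm f g (suc (suc n)) = begin
    (f ⊛ g) (suc (suc n))                                 ≡⟨ ⊛-suc f g (suc n) ⟩
    a + (shift f ⊛ g) (suc n)                             ≡⟨ cong (_+_ a) (trans (⊛-comm (shift f) g (suc n)) (⊛-suc g (shift f) n)) ⟩
    a + (b + (shift g ⊛ shift f) n)                       ≡⟨ cong (λ z → a + (b + z)) (⊛-comm (shift g) (shift f) n) ⟩
    a + (b + (shift f ⊛ shift g) n)                       ≡⟨ swap a b _ ⟩
    b + (a + (shift f ⊛ shift g) n)                       ≡⟨ cong (_+_ b) (trans (⊛-comm (shift g) f (suc n)) (⊛-suc f (shift g) n)) ⟨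
    b + (shift g ⊛ f) (suc n)                             ≡⟨ ⊛-suc g f (suc n) ⟨
    (g ⊛ f) (suc (suc n))                                 ∎
    where
    open ≡-Reasoning
    a = f 0 * g (suc (suc n))
    b = g 0 * f (suc (suc n))
    swap : ∀ a b c → a + (b + c) ≡ b + (a + c)
    swap = solve-∀

  ⊛-distribʳ-⊕ : ∀ f g h → (f ⊕ g) ⊛ h ≐ f ⊛ h ⊕ g ⊛ h
  ⊛-distribʳ-⊕ f g h zero = rearrange (f 0) (g 0) (h 0)
    where
    rearrange : ∀ a b c → (a + b) * c + + 0 ≡ (a * c + + 0) + (b * c + + 0)
    rearrange = solve-∀
  ⊛-distribʳ-⊕ f g h (suc n) = begin
    ((f ⊕ g) ⊛ h) (suc n)                                            ≡⟨ ⊛-suc (f ⊕ g) h n ⟩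
    (f 0 + g 0) * h (suc n) + ((shift f ⊕ shift g) ⊛ h) n            ≡⟨ cong (_+_ ((f 0 + g 0) * h (suc n))) (⊛-distribʳ-⊕ (shift f) (shift g) h n) ⟩
    (f 0 + g 0) * h (suc n) + ((shift f ⊛ h) n + (shift g ⊛ h) n)    ≡⟨ rearrange (f 0) (g 0) (h (suc n)) _ _ ⟩
    (f 0 * h (suc n) + (shift f ⊛ h) n) + (g 0 * h (suc n) + (shift g ⊛ h) n) ≡⟨ cong₂ _+_ (⊛-suc f h n) (⊛-suc g h n) ⟨
    (f ⊛ h ⊕ g ⊛ h) (suc n)                                          ∎
    where
    open ≡-Reasoning
    rearrange : ∀ a b c x y → (a + b) * c + (x + y) ≡ (a * c + x) + (b * c + y)
    rearrange = solve-∀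

  ⊛-distribˡ-⊕ : ∀ f g h → f ⊛ (g ⊕ h) ≐ f ⊛ g ⊕ f ⊛ h
  ⊛-distribˡ-⊕ f g h n = trans (⊛-comm f (g ⊕ h) n)
    (trans (⊛-distribʳ-⊕ g h f n) (cong₂ _+_ (⊛-comm g f n) (⊛-comm h f n)))

  ⊛-scaleˡ : ∀ c f g → (c ·ˢ f) ⊛ g ≐ c ·ˢ (f ⊛ g)
  ⊛-scaleˡ c f g zero = rearrange c (f 0) (g 0)
    where
    rearrange : ∀ c a b → c * a * b + + 0 ≡ c * (a * b + + 0)
    rearrange = solve-∀
  ⊛-scaleˡ c f g (suc n) = begin
    ((c ·ˢ f) ⊛ g) (suc n)                         ≡⟨ ⊛-suc (c ·ˢ f) g n ⟩
    c * f 0 * g (suc n) + ((c ·ˢ shift f) ⊛ g) n   ≡⟨ cong (_+_ (c * f 0 * g (suc n))) (⊛-scaleˡ c (shift f) g n) ⟩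
    c * f 0 * g (suc n) + c * (shift f ⊛ g) n      ≡⟨ rearrange c (f 0) (g (suc n)) _ ⟩
    c * (f 0 * g (suc n) + (shift f ⊛ g) n)        ≡⟨ cong (c *_) (⊛-suc f g n) ⟨
    (c ·ˢ (f ⊛ g)) (suc n)                         ∎
    where
    open ≡-Reasoning
    rearrange : ∀ c a b x → c * a * b + c * x ≡ c * (a * b + x)
    rearrange = solve-∀

  ⊛-scaleʳ : ∀ c f g → f ⊛ (c ·ˢ g) ≐ c ·ˢ (f ⊛ g)
  ⊛-scaleʳ c f g n = trans (⊛-comm f (c ·ˢ g) n) (trans (⊛-scaleˡ c g f n) (cong (c *_) (⊛-comm g f n)))

  ⊛-assoc : ∀ f g h → (f ⊛ g) ⊛ h ≐ f ⊛ (g ⊛ h)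
  ⊛-assoc f g h zero = rearrange (f 0) (g 0) (h 0)
    where
    rearrange : ∀ a b c → (a * b + + 0) * c + + 0 ≡ a * (b * c + + 0) + + 0
    rearrange = solve-∀
  ⊛-assoc f g h (suc n) = begin
    ((f ⊛ g) ⊛ h) (suc n)                                                   ≡⟨ ⊛-suc (f ⊛ g) h n ⟩
    (f ⊛ g) 0 * h (suc n) + (shift (f ⊛ g) ⊛ h) n                           ≡⟨ cong (_+_ ((f ⊛ g) 0 * h (suc n))) (begin
        (shift (f ⊛ g) ⊛ h) n                                                 ≡⟨ ⊛-congʳ h (⊛-suc f g) n ⟩
        ((f 0 ·ˢ shift g ⊕ shift f ⊛ g) ⊛ h) n                                ≡⟨ ⊛-distribʳ-⊕ (f 0 ·ˢ shift g) (shift f ⊛ g) h n ⟩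
        ((f 0 ·ˢ shift g) ⊛ h) n + ((shift f ⊛ g) ⊛ h) n                      ≡⟨ cong₂ _+_ (⊛-scaleˡ (f 0) (shift g) h n) (⊛-assoc (shift f) g h n) ⟩
        f 0 * (shift g ⊛ h) n + (shift f ⊛ (g ⊛ h)) n                         ∎) ⟩
    (f 0 * g 0 + + 0) * h (suc n) + (f 0 * (shift g ⊛ h) n + (shift f ⊛ (g ⊛ h)) n)
                                                                            ≡⟨ rearrange (f 0) (g 0) (h (suc n)) _ _ ⟩
    f 0 * (g 0 * h (suc n) + (shift g ⊛ h) n) + (shift f ⊛ (g ⊛ h)) n       ≡⟨ cong (λ z → f 0 * z + (shift f ⊛ (g ⊛ h)) n) (⊛-suc g h n) ⟨
    f 0 * (g ⊛ h) (suc n) + (shift f ⊛ (g ⊛ h)) n                           ≡⟨ ⊛-suc f (g ⊛ h) n ⟨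
    (f ⊛ (g ⊛ h)) (suc n)                                                   ∎
    where
    open ≡-Reasoning
    rearrange : ∀ a b c x y → (a * b + + 0) * c + (a * x + y) ≡ a * (b * c + x) + y
    rearrange = solve-∀

  ⊛-zeroˡ : ∀ g → 𝟘 ⊛ g ≐ 𝟘
  ⊛-zeroˡ g zero    = refl
  ⊛-zeroˡ g (suc n) = trans (⊛-suc 𝟘 g n) (cong (_+_ (+ 0 * g (suc n))) (⊛-zeroˡ g n))

  ⊛-zeroʳ : ∀ g → g ⊛ 𝟘 ≐ 𝟘
  ⊛-zeroʳ g n = trans (⊛-comm g 𝟘 n) (⊛-zeroˡ g n)

  ⊛-identityˡ : ∀ g → one ⊛ g ≐ g
  ⊛-identityˡ g zero    = trans (ℤP.+-identityʳ (+ 1 * g 0)) (ℤP.*-identityˡ (g 0))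
  ⊛-identityˡ g (suc n) = begin
    (one ⊛ g) (suc n)                      ≡⟨ ⊛-suc one g n ⟩
    + 1 * g (suc n) + (shift one ⊛ g) n    ≡⟨ cong₂ _+_ (ℤP.*-identityˡ (g (suc n))) (⊛-zeroˡ g n) ⟩
    g (suc n) + + 0                        ≡⟨ ℤP.+-identityʳ (g (suc n)) ⟩
    g (suc n)                              ∎
    where open ≡-Reasoning

  ⊛-identityʳ : ∀ g → g ⊛ one ≐ g
  ⊛-identityʳ g n = trans (⊛-comm g one n) (⊛-identityˡ g n)

  ⊛-distribʳ-⊖ : ∀ f g h → (f ⊖ g) ⊛ h ≐ f ⊛ h ⊖ g ⊛ h
  ⊛-distribʳ-⊖ f g h n = begin
    ((f ⊖ g) ⊛ h) n                  ≡⟨ ⊛-congʳ h (λ i → cong (_+_ (f i)) (ℤP.-1*i≡-i (g i))) n ⟨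
    ((f ⊕ -1ℤ ·ˢ g) ⊛ h) n           ≡⟨ ⊛-distribʳ-⊕ f (-1ℤ ·ˢ g) h n ⟩
    (f ⊛ h) n + ((-1ℤ ·ˢ g) ⊛ h) n   ≡⟨ cong (_+_ ((f ⊛ h) n)) (trans (⊛-scaleˡ -1ℤ g h n) (ℤP.-1*i≡-i _)) ⟩
    (f ⊛ h ⊖ g ⊛ h) n                ∎
    where open ≡-Reasoning

  ⊛-distribˡ-⊖ : ∀ f g h → f ⊛ (g ⊖ h) ≐ f ⊛ g ⊖ f ⊛ h
  ⊛-distribˡ-⊖ f g h n = trans (⊛-comm f (g ⊖ h) n)
    (trans (⊛-distribʳ-⊖ g h f n) (cong₂ _-_ (⊛-comm g f n) (⊛-comm h f n)))

  ⊛-commutativeMonoid : CommutativeMonoid _ _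
  ⊛-commutativeMonoid = record
    { Carrier = FPS
    ; _≈_     = _≐_
    ; _∙_     = _⊛_
    ; ε       = one
    ; isCommutativeMonoid = record
      { isMonoid = record
        { isSemigroup = record
          { isMagma = record { isEquivalence = Setoid.isEquivalence ≐-setoid ; ∙-cong = ⊛-cong }
          ; assoc   = ⊛-assoc
          }
        ; identity = ⊛-identityˡ , ⊛-identityʳ
        }
      ; comm = ⊛-comm
      }
    }

  mono-⊛-< : ∀ m g {n} → n < m → (mono m ⊛ g) n ≡ + 0
  mono-⊛-< (suc m) g {zero}  _         = refl
  mono-⊛-< (suc m) g {suc n} (s≤s n<m) = begin
    (mono (suc m) ⊛ g) (suc n)                        ≡⟨ ⊛-suc (mono (suc m)) g n ⟩
    + 0 * g (suc n) + (shift (mono (suc m)) ⊛ g) n    ≡⟨ cong (_+_ (+ 0 * g (suc n))) (mono-⊛-< m g n<m) ⟩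
    + 0                                               ∎
    where open ≡-Reasoning

  mono-⊛-+ : ∀ m g n → (mono m ⊛ g) (m ℕ.+ n) ≡ g n
  mono-⊛-+ zero    g n = trans (⊛-congʳ g mono-zero n) (⊛-identityˡ g n)
    where
    mono-zero : mono 0 ≐ one
    mono-zero zero    = refl
    mono-zero (suc _) = refl
  mono-⊛-+ (suc m) g n = begin
    (mono (suc m) ⊛ g) (suc (m ℕ.+ n))                              ≡⟨ ⊛-suc (mono (suc m)) g (m ℕ.+ n) ⟩
    + 0 * g (suc (m ℕ.+ n)) + (shift (mono (suc m)) ⊛ g) (m ℕ.+ n)  ≡⟨ cong (_+_ (+ 0 * g (suc (m ℕ.+ n)))) (mono-⊛-+ m g n) ⟩
    + 0 + g n                                                       ≡⟨ ℤP.+-identityˡ (g n) ⟩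
    g n                                                             ∎
    where open ≡-Reasoning

  1-q^ : ℕ → FPS
  1-q^ m = one ⊖ mono m

  1-q^-⊛ : ∀ m f → 1-q^ m ⊛ f ≐ f ⊖ mono m ⊛ f
  1-q^-⊛ m f n = trans (⊛-distribʳ-⊖ one (mono m) f n) (cong (_- (mono m ⊛ f) n) (⊛-identityˡ f n))

  ⊛-1-q^-< : ∀ m f {n} → n < m → (f ⊛ 1-q^ m) n ≡ f n
  ⊛-1-q^-< m f {n} n<m = begin
    (f ⊛ 1-q^ m) n                ≡⟨ ⊛-distribˡ-⊖ f one (mono m) n ⟩
    (f ⊛ one) n - (f ⊛ mono m) n  ≡⟨ cong₂ _-_ (⊛-identityʳ f n) (trans (⊛-comm f (mono m) n) (mono-⊛-< m f n<m)) ⟩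
    f n - + 0                     ≡⟨ ℤP.+-identityʳ (f n) ⟩
    f n                           ∎
    where open ≡-Reasoning

  lambertTerm-< : ∀ m n → n < m → lambertTerm m n ≡ + 0
  lambertTerm-< m n = mono-⊛-< m (inv (1-q^ m))

  Stabilizes : (ℕ → FPS) → Set
  Stabilizes F = ∀ b → F (suc b) ≈[ b ] F b

  stable-diagonal : ∀ {F} → Stabilizes F → ∀ {a j} → j ≤ a → F a j ≡ F j j
  stable-diagonal F-stable {zero}  z≤n = refl
  stable-diagonal F-stable {suc a} {j} j≤1+a with j ≤? a
  ... | yes j≤a = trans (F-stable a j j≤a) (stable-diagonal F-stable j≤a)
  ... | no  j≰a with ℕP.≤-antisym j≤1+a (ℕP.≰⇒> j≰a)
  ...   | refl = refl

  stable-coeff : ∀ {F} → Stabilizes F → ∀ {a a' j} → j ≤ a → j ≤ a' → F a j ≡ F a' j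
  stable-coeff F-stable j≤a j≤a' = trans (stable-diagonal F-stable j≤a) (sym (stable-diagonal F-stable j≤a'))

  invUpTo-≤ : ∀ f {m n} → m ≤ n → invUpTo f (suc n) m ≡ invUpTo f n m
  invUpTo-≤ f {m} {n} m≤n with m ℕ.≤ᵇ n | ℕP.≤⇒≤ᵇ m≤n
  ... | true | _ = refl

  invUpTo-> : ∀ f {m n} → ¬ m ≤ n → invUpTo f (suc n) m ≡ - (shift f ⊛ invUpTo f n) n
  invUpTo-> f {m} {n} m≰n with m ℕ.≤ᵇ n | ℕP.≤ᵇ⇒≤ m n
  ... | true  | ≤ᵇ⇒≤ = contradiction (≤ᵇ⇒≤ _) m≰n
  ... | false | _    = refl

  invUpTo-stable : ∀ f {m} n → m ≤ n → invUpTo f n m ≡ inv f m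
  invUpTo-stable f n = stable-diagonal (λ b j j≤b → invUpTo-≤ f j≤b)

  inv-suc : ∀ f n → inv f (suc n) ≡ - (shift f ⊛ inv f) n
  inv-suc f n = trans (invUpTo-> f {suc n} {n} (ℕP.<-irrefl refl))
    (cong -_ (⊛-coeff-cong n {shift f} (λ _ _ → refl) (λ i i≤n → invUpTo-stable f n i≤n)))

  ⊛-inverseʳ : ∀ f → f 0 ≡ + 1 → f ⊛ inv f ≐ one
  ⊛-inverseʳ f f₀≡1 zero rewrite f₀≡1 = refl
  ⊛-inverseʳ f f₀≡1 (suc n) = begin
    (f ⊛ inv f) (suc n)                                   ≡⟨ ⊛-suc f (inv f) n ⟩
    f 0 * inv f (suc n) + (shift f ⊛ inv f) n             ≡⟨ cong₂ (λ a b → a * b + (shift f ⊛ inv f) n) f₀≡1 (inv-suc f n) ⟩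
    + 1 * - (shift f ⊛ inv f) n + (shift f ⊛ inv f) n     ≡⟨ cancel ((shift f ⊛ inv f) n) ⟩
    + 0                                                   ∎
    where
    open ≡-Reasoning
    cancel : ∀ a → + 1 * - a + a ≡ + 0
    cancel = solve-∀

  ⊛-inverseˡ : ∀ f → f 0 ≡ + 1 → inv f ⊛ f ≐ one
  ⊛-inverseˡ f f₀≡1 n = trans (⊛-comm (inv f) f n) (⊛-inverseʳ f f₀≡1 n)

  invUpTo-cong-≈ : ∀ {f g} n → f ≈[ n ] g → ∀ m → invUpTo f n m ≡ invUpTo g n m
  invUpTo-cong-≈         zero    _   _ = refl
  invUpTo-cong-≈ {f} {g} (suc n) f≈g m with m ≤? n
  ... | yes m≤n = begin
    invUpTo f (suc n) m   ≡⟨ invUpTo-≤ f m≤n ⟩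
    invUpTo f n m         ≡⟨ invUpTo-cong-≈ n (≈-≤ (ℕP.n≤1+n n) f≈g) m ⟩
    invUpTo g n m         ≡⟨ invUpTo-≤ g m≤n ⟨
    invUpTo g (suc n) m   ∎
    where open ≡-Reasoning
  ... | no m≰n = begin
    invUpTo f (suc n) m                  ≡⟨ invUpTo-> f m≰n ⟩
    - (shift f ⊛ invUpTo f n) n          ≡⟨ cong -_ (⊛-coeff-cong n (λ i i≤n → f≈g (suc i) (s≤s i≤n))
                                                   (λ i _ → invUpTo-cong-≈ n (≈-≤ (ℕP.n≤1+n n) f≈g) i)) ⟩
    - (shift g ⊛ invUpTo g n) n          ≡⟨ invUpTo-> g m≰n ⟨
    invUpTo g (suc n) m                  ∎
    where open ≡-Reasoning

  inv-cong-≈ : ∀ {f g} n → f ≈[ n ] g → inv f ≈[ n ] inv g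
  inv-cong-≈ n f≈g i i≤n = invUpTo-cong-≈ i (≈-≤ i≤n f≈g) i

  ⊛-cancelˡ : ∀ u {f g} → u 0 ≡ + 1 → u ⊛ f ≐ u ⊛ g → f ≐ g
  ⊛-cancelˡ u {f} {g} u₀≡1 uf≐ug = begin
    f                 ≈⟨ ⊛-identityˡ f ⟨
    one ⊛ f           ≈⟨ ⊛-congʳ f (⊛-inverseˡ u u₀≡1) ⟨
    (inv u ⊛ u) ⊛ f   ≈⟨ ⊛-assoc (inv u) u f ⟩
    inv u ⊛ (u ⊛ f)   ≈⟨ ⊛-congˡ (inv u) uf≐ug ⟩
    inv u ⊛ (u ⊛ g)   ≈⟨ ⊛-assoc (inv u) u g ⟨
    (inv u ⊛ u) ⊛ g   ≈⟨ ⊛-congʳ g (⊛-inverseˡ u u₀≡1) ⟩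
    one ⊛ g           ≈⟨ ⊛-identityˡ g ⟩
    g                 ∎
    where open ≐-Reasoning

  Σ≤-+-vanishing : ∀ h a e → (∀ i → 0 < i → i ≤ e → h (a ℕ.+ i) ≡ + 0) → Σ≤ (a ℕ.+ e) h ≡ Σ≤ a h
  Σ≤-+-vanishing h a zero    _         = cong (λ n → Σ≤ n h) (ℕP.+-identityʳ a)
  Σ≤-+-vanishing h a (suc e) vanishing = begin
    Σ≤ (a ℕ.+ suc e) h                    ≡⟨ cong (λ n → Σ≤ n h) (ℕP.+-suc a e) ⟩
    Σ≤ (suc (a ℕ.+ e)) h                  ≡⟨ Σ≤-snoc (a ℕ.+ e) h ⟩
    Σ≤ (a ℕ.+ e) h + h (suc (a ℕ.+ e))    ≡⟨ cong₂ _+_ (Σ≤-+-vanishing h a e (λ i 0<i i≤e → vanishing i 0<i (ℕP.m≤n⇒m≤1+n i≤e)))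
                                                       (trans (cong h (sym (ℕP.+-suc a e))) (vanishing (suc e) (s≤s z≤n) ℕP.≤-refl)) ⟩
    Σ≤ a h + + 0                          ≡⟨ ℤP.+-identityʳ (Σ≤ a h) ⟩
    Σ≤ a h                                ∎
    where open ≡-Reasoning

  -- the upper limit k N + (k - 1) closes the last block of k indices
  Σ≤-multiples : ∀ k-1 N h → (∀ m → ¬ suc k-1 ∣ m → h m ≡ + 0) →
                 Σ≤ (suc k-1 ℕ.* N ℕ.+ k-1) h ≡ Σ≤ N (λ j → h (j ℕ.* suc k-1))
  Σ≤-multiples k-1 zero    h supported = trans (cong (λ n → Σ≤ (n ℕ.+ k-1) h) (ℕP.*-zeroʳ k-1))
    (Σ≤-+-vanishing h 0 k-1 (λ i 0<i i≤k-1 → supported i (subst (λ n → ¬ k ∣ n ℕ.+ i) (ℕP.*-zeroʳ k) (¬∣-between k 0 i 0<i (s≤s i≤k-1)))))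
    where k = suc k-1
  Σ≤-multiples k-1 (suc N) h supported = begin
    Σ≤ (k ℕ.* suc N ℕ.+ k-1) h                ≡⟨ Σ≤-+-vanishing h (k ℕ.* suc N) k-1
                                                   (λ i 0<i i≤k-1 → supported _ (¬∣-between k (suc N) i 0<i (s≤s i≤k-1))) ⟩
    Σ≤ (k ℕ.* suc N) h                        ≡⟨ cong (λ n → Σ≤ n h) kN+k≡1+last ⟩
    Σ≤ (suc (k ℕ.* N ℕ.+ k-1)) h              ≡⟨ Σ≤-snoc (k ℕ.* N ℕ.+ k-1) h ⟩
    Σ≤ (k ℕ.* N ℕ.+ k-1) h + h (suc (k ℕ.* N ℕ.+ k-1))
                                              ≡⟨ cong₂ _+_ (Σ≤-multiples k-1 N h supported) (cong h (trans (sym kN+k≡1+last) (ℕP.*-comm k (suc N)))) ⟩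
    Σ≤ N (λ j → h (j ℕ.* k)) + h (suc N ℕ.* k) ≡⟨ Σ≤-snoc N (λ j → h (j ℕ.* k)) ⟨
    Σ≤ (suc N) (λ j → h (j ℕ.* k))            ∎
    where
    open ≡-Reasoning
    k = suc k-1
    kN+k≡1+last : k ℕ.* suc N ≡ suc (k ℕ.* N ℕ.+ k-1)
    kN+k≡1+last = trans (ℕP.*-suc k N) (trans (ℕP.+-comm k (k ℕ.* N)) (ℕP.+-suc (k ℕ.* N) k-1))

  summand : (ℕ → Bool) → (ℕ → FPS) → ℕ → ℕ → ℤ
  summand cond term n m = if cond m then (if does (m ℕ.≟ 0) then + 0 else term m n) else + 0

  sumOver-cong : ∀ {c c'} f → (∀ m → c m ≡ c' m) → sumOver c f ≐ sumOver c' f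
  sumOver-cong f c≗c' n = Σ≤-cong n (λ m → cong (λ b → if b then (if does (m ℕ.≟ 0) then + 0 else f m n) else + 0) (c≗c' m))

  sumOver-not-∧ : ∀ (p c : ℕ → Bool) f → sumOver (λ m → not (p m) ∧ c m) f ≐ sumOver c f ⊖ sumOver (λ m → p m ∧ c m) f
  sumOver-not-∧ p c f n = trans (Σ≤-cong n split-summand) (Σ≤-⊖ n (summand c f n) (summand (λ m → p m ∧ c m) f n))
    where
    nonzero-term : ℕ → ℤ
    nonzero-term m = if does (m ℕ.≟ 0) then + 0 else f m n
    split-summand : ∀ m → summand (λ m → not (p m) ∧ c m) f n m ≡ (summand c f n ⊖ summand (λ m → p m ∧ c m) f n) m
    split-summand m with p m | c m
    ... | true  | true  = sym (ℤP.+-inverseʳ (nonzero-term m))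
    ... | true  | false = refl
    ... | false | true  = sym (ℤP.+-identityʳ (nonzero-term m))
    ... | false | false = refl

  sumOver-multiples : ∀ k-1 (c : ℕ → Bool) f → (∀ m n → n < m → f m n ≡ + 0) →
                      sumOver (λ m → does (suc k-1 ∣? m) ∧ c m) f ≐ sumOver (λ j → c (j ℕ.* suc k-1)) (λ j → f (j ℕ.* suc k-1))
  sumOver-multiples k-1 c f f-vanishes n = begin
    Σ≤ n h                                ≡⟨ Σ≤-+-vanishing h n (k-1 ℕ.* n ℕ.+ k-1) (λ i 0<i _ → beyond-n (n ℕ.+ i) (ℕP.m<m+n n 0<i)) ⟨
    Σ≤ (n ℕ.+ (k-1 ℕ.* n ℕ.+ k-1)) h      ≡⟨ cong (λ m → Σ≤ m h) (ℕP.+-assoc n (k-1 ℕ.* n) k-1) ⟨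
    Σ≤ (k ℕ.* n ℕ.+ k-1) h                ≡⟨ Σ≤-multiples k-1 n h off-multiples ⟩
    Σ≤ n (λ j → h (j ℕ.* k))              ≡⟨ Σ≤-cong n at-multiples ⟩
    Σ≤ n (summand (λ j → c (j ℕ.* k)) (λ j → f (j ℕ.* k)) n) ∎
    where
    open ≡-Reasoning
    k = suc k-1
    h = summand (λ m → does (k ∣? m) ∧ c m) f n
    beyond-n : ∀ m → n < m → h m ≡ + 0
    beyond-n m n<m with does (k ∣? m) ∧ c m | does (m ℕ.≟ 0)
    ... | true  | true  = refl
    ... | true  | false = f-vanishes m n n<m
    ... | false | _     = refl
    off-multiples : ∀ m → ¬ k ∣ m → h m ≡ + 0
    off-multiples m ¬k∣m rewrite dec-false (k ∣? m) ¬k∣m = refl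
    at-multiples : ∀ j → h (j ℕ.* k) ≡ summand (λ j → c (j ℕ.* k)) (λ j → f (j ℕ.* k)) n j
    at-multiples zero    = trans (if-eta (does (k ∣? 0) ∧ c 0)) (sym (if-eta (c 0)))
    at-multiples (suc j) rewrite dec-true (k ∣? (suc j ℕ.* k)) (n∣m*n (suc j)) = refl

module Partitions (allowed marked : ℕ → Bool) where
  open import Data.Nat using (ℕ; zero; suc; _+_; _*_; _∸_; _≤_; _≤?_; s≤s)
  import Data.Nat.Properties as ℕP
  open import Data.Bool as Bool using (true; false; if_then_else_)
  open import Data.List using (List; []; _∷_; map; filter; concatMap; concat; applyUpTo; length; _++_; [_])
  import Data.List.Properties as LP
  import Data.List.Relation.Unary.All.Properties as All
  open import Data.Nat.ListAction using (sum)
  import Data.Nat.ListAction.Properties as ΣP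
  open import Data.Bool.ListAction using () renaming (all to allL)
  open import Relation.Binary.PropositionalEquality hiding ([_])
  open import Function using (_∘′_)
  open import Data.Nat.Tactic.RingSolver using (solve-∀)

  admissible : List (List ℕ) → List (List ℕ)
  admissible = filter (λ λs → allL allowed λs Bool.≟ true)

  markedParts : List ℕ → ℕ
  markedParts λs = length (filter (λ p → marked p Bool.≟ true) λs)

  isMarked : ℕ → ℕ
  isMarked p = if marked p then 1 else 0

  total : (List ℕ → ℕ) → List (List ℕ) → ℕ
  total φ Ls = sum (map φ (admissible Ls))

  count : List (List ℕ) → ℕ
  count = total (λ _ → 1)

  markedParts-∷ : ∀ p λs → markedParts (p ∷ λs) ≡ isMarked p + markedParts λs
  markedParts-∷ p λs with marked p
  ... | true  = refl
  ... | false = refl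

  total-++ : ∀ φ Ls Ms → total φ (Ls ++ Ms) ≡ total φ Ls + total φ Ms
  total-++ φ Ls Ms = begin
    sum (map φ (admissible (Ls ++ Ms)))                       ≡⟨ cong (sum ∘′ map φ) (LP.filter-++ _ Ls Ms) ⟩
    sum (map φ (admissible Ls ++ admissible Ms))              ≡⟨ cong sum (LP.map-++ φ (admissible Ls) _) ⟩
    sum (map φ (admissible Ls) ++ map φ (admissible Ms))      ≡⟨ ΣP.sum-++ (map φ (admissible Ls)) _ ⟩
    total φ Ls + total φ Ms                                   ∎
    where open ≡-Reasoning

  total-prepend : ∀ φ c p → (∀ λs → φ (p ∷ λs) ≡ c + φ λs) → ∀ Ls →
                  total φ (map (p ∷_) Ls) ≡ (if allowed p then c * count Ls + total φ Ls else 0)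
  total-prepend φ c p φ-∷ [] with allowed p
  ... | true  = sym (trans (ℕP.+-identityʳ (c * 0)) (ℕP.*-zeroʳ c))
  ... | false = refl
  total-prepend φ c p φ-∷ (λs ∷ Ls) with allowed p | total-prepend φ c p φ-∷ Ls
  ... | false | ih = ih
  ... | true  | ih with allL allowed λs
  ...   | false = ih
  ...   | true  = begin
    φ (p ∷ λs) + total φ (map (p ∷_) Ls)          ≡⟨ cong₂ _+_ (φ-∷ λs) ih ⟩
    (c + φ λs) + (c * count Ls + total φ Ls)      ≡⟨ rearrange c (φ λs) (count Ls) (total φ Ls) ⟩
    c * suc (count Ls) + (φ λs + total φ Ls)      ∎
    where
    open ≡-Reasoning
    rearrange : ∀ c x n t → (c + x) + (c * n + t) ≡ c * (1 + n) + (x + t)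
    rearrange = solve-∀

  parts-fuel : ∀ f g n b → n ≤ f → n ≤ g → parts f n b ≡ parts g n b
  parts-fuel _       _       zero    _ _         _         = refl
  parts-fuel (suc f) (suc g) (suc n) b (s≤s n≤f) (s≤s n≤g) =
    cong concat (LP.map-cong-local (All.filter⁺ _ (All.applyUpTo⁺₂ suc b same-branch)))
    where
    same-branch : ∀ i → map (suc i ∷_) (parts f (n ∸ i) (suc i)) ≡ map (suc i ∷_) (parts g (n ∸ i) (suc i))
    same-branch i = cong (map (suc i ∷_)) (parts-fuel f g (n ∸ i) (suc i)
                      (ℕP.≤-trans (ℕP.m∸n≤m n i) n≤f) (ℕP.≤-trans (ℕP.m∸n≤m n i) n≤g))

  private
    branches : ℕ → ℕ → ℕ → List (List ℕ)
    branches f n p = map (p ∷_) (parts f (suc n ∸ p) p)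

    parts-snoc : ∀ f n b → parts (suc f) (suc n) (suc b) ≡
                 parts (suc f) (suc n) b ++ concatMap (branches f n) (filter (_≤? suc n) [ suc b ])
    parts-snoc f n b = begin
      concatMap (branches f n) (filter P? (applyUpTo suc (suc b)))
        ≡⟨ cong (concatMap (branches f n) ∘′ filter P?) (LP.applyUpTo-∷ʳ suc b) ⟨
      concatMap (branches f n) (filter P? (applyUpTo suc b ++ [ suc b ]))
        ≡⟨ cong (concatMap (branches f n)) (LP.filter-++ P? (applyUpTo suc b) _) ⟩
      concatMap (branches f n) (filter P? (applyUpTo suc b) ++ filter P? [ suc b ])
        ≡⟨ LP.concatMap-++ (branches f n) (filter P? (applyUpTo suc b)) _ ⟩
      parts (suc f) (suc n) b ++ concatMap (branches f n) (filter P? [ suc b ])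
        ∎
      where
      open ≡-Reasoning
      P? = _≤? suc n

  parts-bound-suc-≤ : ∀ n b → n ≤ b → parts n n (suc b) ≡ parts n n b
  parts-bound-suc-≤ zero    b _     = refl
  parts-bound-suc-≤ (suc n) b 1+n≤b = begin
    parts (suc n) (suc n) (suc b)                            ≡⟨ parts-snoc n n b ⟩
    smaller ++ concatMap (branches n n) (filter P? [ suc b ]) ≡⟨ cong (λ ps → smaller ++ concatMap (branches n n) ps)
                                                                     (LP.filter-reject P? (ℕP.<⇒≱ (s≤s 1+n≤b))) ⟩
    smaller ++ []                                            ≡⟨ LP.++-identityʳ smaller ⟩
    smaller                                                  ∎
    where
    open ≡-Reasoning
    P? = _≤? suc n
    smaller = parts (suc n) (suc n) b

  parts-bound-suc-+ : ∀ b j → parts (suc (b + j)) (suc (b + j)) (suc b) ≡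
                              parts (suc (b + j)) (suc (b + j)) b ++ map (suc b ∷_) (parts j j (suc b))
  parts-bound-suc-+ b j = begin
    parts (suc n) (suc n) (suc b)                            ≡⟨ parts-snoc n n b ⟩
    smaller ++ concatMap (branches n n) (filter P? [ suc b ]) ≡⟨ cong (λ ps → smaller ++ concatMap (branches n n) ps)
                                                                     (LP.filter-accept P? (s≤s (ℕP.m≤m+n b j))) ⟩
    smaller ++ (branches n n (suc b) ++ [])                  ≡⟨ cong (smaller ++_) (LP.++-identityʳ _) ⟩
    smaller ++ map (suc b ∷_) (parts n (n ∸ b) (suc b))      ≡⟨ cong (λ ps → smaller ++ map (suc b ∷_) ps) enough-fuel ⟩
    smaller ++ map (suc b ∷_) (parts j j (suc b))            ∎
    where
    open ≡-Reasoning
    n = b + j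
    P? = _≤? suc n
    smaller = parts (suc n) (suc n) b
    enough-fuel : parts n (n ∸ b) (suc b) ≡ parts j j (suc b)
    enough-fuel = trans (cong (λ m → parts n m (suc b)) (ℕP.m+n∸m≡n b j)) (parts-fuel n j j (suc b) (ℕP.m≤n+m j b) ℕP.≤-refl)

module PartitionSeries (allowed marked : ℕ → Bool) where
  open PowerSeries
  open Partitions allowed marked
  open import Data.Nat as ℕ using (zero; suc; _≤_; _<_; _≤?_; s≤s; z≤n)
  import Data.Nat.Properties as ℕP
  open import Data.Integer using (+_; _+_; _*_; _-_)
  import Data.Integer.Properties as ℤP
  open import Data.Integer.Tactic.RingSolver using (solve-∀)
  open import Data.Bool using (true; false; if_then_else_; _∧_)
  open import Data.List using (List; _∷_; map; _++_)
  open import Algebra.Bundles using (CommutativeMonoid)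
  open import Algebra.Properties.CommutativeSemigroup (CommutativeMonoid.commutativeSemigroup ⊛-commutativeMonoid)
    using (interchange; xy∙z≈xz∙y; x∙yz≈y∙xz)
  open import Function using (_∘_)
  open import Relation.Binary.PropositionalEquality
  open import Relation.Nullary using (yes; no)

  series : (List ℕ → ℕ) → ℕ → FPS
  series φ b n = + total φ (parts n n b)

  countGF : ℕ → FPS
  countGF = series (λ _ → 1)

  markedGF : ℕ → FPS
  markedGF = series markedParts

  data Split (m : ℕ) : ℕ → Set where
    below  : ∀ {n} → n < m → Split m n
    beyond : ∀ j → Split m (m ℕ.+ j)

  split : ∀ m n → Split m n
  split m n with m ≤? n
  ... | yes m≤n = subst (Split m) (ℕP.m+[n∸m]≡n m≤n) (beyond (n ℕ.∸ m))
  ... | no  m≰n = below (ℕP.≰⇒> m≰n)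

  -- coefficient j is the φ-total over the allowed partitions of suc b + j with largest part suc b
  withLargest : (List ℕ → ℕ) → ℕ → FPS
  withLargest φ b j = + total φ (map (suc b ∷_) (parts j j (suc b)))

  series-suc : ∀ φ b → series φ (suc b) ≐ series φ b ⊕ mono (suc b) ⊛ withLargest φ b
  series-suc φ b n with split (suc b) n
  ... | below n<1+b = begin
    + total φ (parts n n (suc b))                     ≡⟨ cong (+_ ∘ total φ) (parts-bound-suc-≤ n b (ℕP.≤-pred n<1+b)) ⟩
    series φ b n                                      ≡⟨ ℤP.+-identityʳ (series φ b n) ⟨
    series φ b n + + 0                                ≡⟨ cong (_+_ (series φ b n)) (mono-⊛-< (suc b) (withLargest φ b) n<1+b) ⟨
    (series φ b ⊕ mono (suc b) ⊛ withLargest φ b) n   ∎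
    where open ≡-Reasoning
  ... | beyond j = begin
    + total φ (parts n n (suc b))                  ≡⟨ cong (+_ ∘ total φ) (parts-bound-suc-+ b j) ⟩
    + total φ (smaller ++ top)                     ≡⟨ cong +_ (total-++ φ smaller top) ⟩
    + (total φ smaller ℕ.+ total φ top)            ≡⟨ ℤP.pos-+ (total φ smaller) (total φ top) ⟩
    series φ b n + + total φ top                   ≡⟨ cong (_+_ (series φ b n)) (mono-⊛-+ (suc b) (withLargest φ b) j) ⟨
    (series φ b ⊕ mono (suc b) ⊛ withLargest φ b) n ∎
    where
    open ≡-Reasoning
    smaller = parts n n b
    top = map (suc b ∷_) (parts j j (suc b))

  module _ (φ : List ℕ → ℕ) (c b : ℕ) (φ-∷ : ∀ λs → φ (suc b ∷ λs) ≡ c ℕ.+ φ λs) where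

    withLargest-allowed : allowed (suc b) ≡ true → withLargest φ b ≐ (+ c) ·ˢ countGF (suc b) ⊕ series φ (suc b)
    withLargest-allowed allowed-b j = begin
      + total φ (map (suc b ∷_) (parts j j (suc b)))     ≡⟨ cong +_ (total-prepend φ c (suc b) φ-∷ Ls) ⟩
      + (if allowed (suc b) then c ℕ.* count Ls ℕ.+ total φ Ls else 0) ≡⟨ cong (λ a → + (if a then c ℕ.* count Ls ℕ.+ total φ Ls else 0)) allowed-b ⟩
      + (c ℕ.* count Ls ℕ.+ total φ Ls)                  ≡⟨ ℤP.pos-+ (c ℕ.* count Ls) _ ⟩
      + (c ℕ.* count Ls) + + total φ Ls                  ≡⟨ cong (_+ + total φ Ls) (ℤP.pos-* c (count Ls)) ⟩
      + c * + count Ls + + total φ Ls                    ∎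
      where
      open ≡-Reasoning
      Ls = parts j j (suc b)

    withLargest-excluded : allowed (suc b) ≡ false → withLargest φ b ≐ 𝟘
    withLargest-excluded excluded-b j = cong +_ (trans (total-prepend φ c (suc b) φ-∷ Ls)
      (cong (λ a → if a then c ℕ.* count Ls ℕ.+ total φ Ls else 0) excluded-b))
      where Ls = parts j j (suc b)

    series-excluded : allowed (suc b) ≡ false → series φ (suc b) ≐ series φ b
    series-excluded excluded-b n = begin
      series φ (suc b) n                                   ≡⟨ series-suc φ b n ⟩
      series φ b n + (mono (suc b) ⊛ withLargest φ b) n    ≡⟨ cong (_+_ (series φ b n)) (trans (⊛-congˡ (mono (suc b)) (withLargest-excluded excluded-b) n)
                                                                                              (⊛-zeroʳ (mono (suc b)) n)) ⟩
      series φ b n + + 0                                   ≡⟨ ℤP.+-identityʳ _ ⟩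
      series φ b n                                         ∎
      where open ≡-Reasoning

    series-allowed : allowed (suc b) ≡ true → 1-q^ (suc b) ⊛ series φ (suc b) ≐ series φ b ⊕ mono (suc b) ⊛ ((+ c) ·ˢ countGF (suc b))
    series-allowed allowed-b n = begin
      (1-q^ (suc b) ⊛ series φ (suc b)) n                      ≡⟨ 1-q^-⊛ (suc b) (series φ (suc b)) n ⟩
      series φ (suc b) n - (mono (suc b) ⊛ series φ (suc b)) n ≡⟨ cong (_- (mono (suc b) ⊛ series φ (suc b)) n) (begin
          series φ (suc b) n                                                       ≡⟨ series-suc φ b n ⟩
          series φ b n + (mono (suc b) ⊛ withLargest φ b) n
            ≡⟨ cong (_+_ (series φ b n)) (⊛-congˡ (mono (suc b)) (withLargest-allowed allowed-b) n) ⟩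
          series φ b n + (mono (suc b) ⊛ ((+ c) ·ˢ countGF (suc b) ⊕ series φ (suc b))) n
            ≡⟨ cong (_+_ (series φ b n)) (⊛-distribˡ-⊕ (mono (suc b)) ((+ c) ·ˢ countGF (suc b)) (series φ (suc b)) n) ⟩
          series φ b n + ((mono (suc b) ⊛ ((+ c) ·ˢ countGF (suc b))) n + (mono (suc b) ⊛ series φ (suc b)) n) ∎) ⟩
      series φ b n + (x + y) - y                               ≡⟨ cancel (series φ b n) x y ⟩
      series φ b n + x                                         ∎
      where
      open ≡-Reasoning
      x = (mono (suc b) ⊛ ((+ c) ·ˢ countGF (suc b))) n
      y = (mono (suc b) ⊛ series φ (suc b)) n
      cancel : ∀ a x y → a + (x + y) - y ≡ a + x
      cancel = solve-∀

  countGF-excluded : ∀ b → allowed (suc b) ≡ false → countGF (suc b) ≐ countGF b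
  countGF-excluded b = series-excluded (λ _ → 1) 0 b (λ _ → refl)

  markedGF-excluded : ∀ b → allowed (suc b) ≡ false → markedGF (suc b) ≐ markedGF b
  markedGF-excluded b = series-excluded markedParts (isMarked (suc b)) b (markedParts-∷ (suc b))

  countGF-allowed : ∀ b → allowed (suc b) ≡ true → 1-q^ (suc b) ⊛ countGF (suc b) ≐ countGF b
  countGF-allowed b allowed-b n = begin
    (1-q^ (suc b) ⊛ countGF (suc b)) n                          ≡⟨ series-allowed (λ _ → 1) 0 b (λ _ → refl) allowed-b n ⟩
    countGF b n + (mono (suc b) ⊛ ((+ 0) ·ˢ countGF (suc b))) n   ≡⟨ cong (_+_ (countGF b n)) (⊛-scaleʳ (+ 0) (mono (suc b)) (countGF (suc b)) n) ⟩
    countGF b n + + 0                                           ≡⟨ ℤP.+-identityʳ _ ⟩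
    countGF b n                                                 ∎
    where open ≡-Reasoning

  markedGF-allowed : ∀ b → allowed (suc b) ≡ true →
                     1-q^ (suc b) ⊛ markedGF (suc b) ≐ markedGF b ⊕ mono (suc b) ⊛ ((+ isMarked (suc b)) ·ˢ countGF (suc b))
  markedGF-allowed b = series-allowed markedParts (isMarked (suc b)) b (markedParts-∷ (suc b))

  eulerProduct : ℕ → FPS
  eulerProduct zero    = one
  eulerProduct (suc b) = eulerProduct b ⊛ 1-q^ (suc b)

  excludedProduct : ℕ → FPS
  excludedProduct zero    = one
  excludedProduct (suc b) = excludedProduct b ⊛ (if allowed (suc b) then one else 1-q^ (suc b))

  lambertSum : ℕ → FPS
  lambertSum zero    = 𝟘
  lambertSum (suc b) = lambertSum b ⊕ (if allowed (suc b) ∧ marked (suc b) then lambertTerm (suc b) else 𝟘)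

  countGF-zero : countGF 0 ≐ one
  countGF-zero zero    = refl
  countGF-zero (suc _) = refl

  markedGF-zero : markedGF 0 ≐ 𝟘
  markedGF-zero zero    = refl
  markedGF-zero (suc _) = refl

  eulerProduct⊛countGF : ∀ b → eulerProduct b ⊛ countGF b ≐ excludedProduct b
  eulerProduct⊛countGF zero = ≐-trans (⊛-identityˡ (countGF 0)) countGF-zero
  eulerProduct⊛countGF (suc b) with allowed (suc b) in allowed-b
  ... | true = begin
    (eulerProduct b ⊛ 1-q^ (suc b)) ⊛ countGF (suc b)  ≈⟨ ⊛-assoc (eulerProduct b) (1-q^ (suc b)) (countGF (suc b)) ⟩
    eulerProduct b ⊛ (1-q^ (suc b) ⊛ countGF (suc b))  ≈⟨ ⊛-congˡ (eulerProduct b) (countGF-allowed b allowed-b) ⟩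
    eulerProduct b ⊛ countGF b                         ≈⟨ eulerProduct⊛countGF b ⟩
    excludedProduct b                                  ≈⟨ ⊛-identityʳ (excludedProduct b) ⟨
    excludedProduct b ⊛ one                            ∎
    where open ≐-Reasoning
  ... | false = begin
    (eulerProduct b ⊛ 1-q^ (suc b)) ⊛ countGF (suc b)  ≈⟨ ⊛-congˡ (eulerProduct b ⊛ 1-q^ (suc b)) (countGF-excluded b allowed-b) ⟩
    (eulerProduct b ⊛ 1-q^ (suc b)) ⊛ countGF b        ≈⟨ xy∙z≈xz∙y (eulerProduct b) (1-q^ (suc b)) (countGF b) ⟩
    (eulerProduct b ⊛ countGF b) ⊛ 1-q^ (suc b)        ≈⟨ ⊛-congʳ (1-q^ (suc b)) (eulerProduct⊛countGF b) ⟩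
    excludedProduct b ⊛ 1-q^ (suc b)                   ∎
    where open ≐-Reasoning

  countGF⊛lambertTerm : ∀ b → allowed (suc b) ≡ true → countGF b ⊛ lambertTerm (suc b) ≐ mono (suc b) ⊛ countGF (suc b)
  countGF⊛lambertTerm b allowed-b = begin
    countGF b ⊛ (q ⊛ inv u)               ≈⟨ ⊛-congʳ (q ⊛ inv u) (countGF-allowed b allowed-b) ⟨
    (u ⊛ countGF m) ⊛ (q ⊛ inv u)         ≈⟨ ⊛-congʳ (q ⊛ inv u) (⊛-comm u (countGF m)) ⟩
    (countGF m ⊛ u) ⊛ (q ⊛ inv u)         ≈⟨ interchange (countGF m) u q (inv u) ⟩
    (countGF m ⊛ q) ⊛ (u ⊛ inv u)         ≈⟨ ⊛-congˡ (countGF m ⊛ q) (⊛-inverseʳ u refl) ⟩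
    (countGF m ⊛ q) ⊛ one                 ≈⟨ ⊛-identityʳ (countGF m ⊛ q) ⟩
    countGF m ⊛ q                         ≈⟨ ⊛-comm (countGF m) q ⟩
    q ⊛ countGF m                         ∎
    where
    open ≐-Reasoning
    m = suc b
    u = 1-q^ m
    q = mono m

  markedGF≐countGF⊛lambertSum : ∀ b → markedGF b ≐ countGF b ⊛ lambertSum b
  markedGF≐countGF⊛lambertSum zero = ≐-trans markedGF-zero (≐-sym (⊛-zeroʳ (countGF 0)))
  markedGF≐countGF⊛lambertSum (suc b) with allowed (suc b) in allowed-b
  ... | false = begin
    markedGF (suc b)                       ≈⟨ markedGF-excluded b allowed-b ⟩
    markedGF b                             ≈⟨ markedGF≐countGF⊛lambertSum b ⟩
    countGF b ⊛ lambertSum b               ≈⟨ ⊛-congʳ (lambertSum b) (countGF-excluded b allowed-b) ⟨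
    countGF (suc b) ⊛ lambertSum b         ≈⟨ ⊛-congˡ (countGF (suc b)) (λ n → ℤP.+-identityʳ (lambertSum b n)) ⟨
    countGF (suc b) ⊛ (lambertSum b ⊕ 𝟘)   ∎
    where open ≐-Reasoning
  -- after multiplying by 1 - q^m both sides become markedGF b + ε q^m countGF m
  ... | true = ⊛-cancelˡ (1-q^ m) refl (begin
    1-q^ m ⊛ markedGF m                                       ≈⟨ markedGF-allowed b allowed-b ⟩
    markedGF b ⊕ mono m ⊛ (ε ·ˢ countGF m)                    ≈⟨ ⊕-cong (markedGF≐countGF⊛lambertSum b) scaled ⟩
    countGF b ⊛ lambertSum b ⊕ countGF b ⊛ (ε ·ˢ lambertTerm m)  ≈⟨ ⊛-distribˡ-⊕ (countGF b) (lambertSum b) (ε ·ˢ lambertTerm m) ⟨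
    countGF b ⊛ (lambertSum b ⊕ ε ·ˢ lambertTerm m)            ≈⟨ ⊛-congˡ (countGF b) (⊕-cong {lambertSum b} ≐-refl marked-term) ⟨
    countGF b ⊛ S                                              ≈⟨ ⊛-congʳ S (countGF-allowed b allowed-b) ⟨
    (1-q^ m ⊛ countGF m) ⊛ S                                   ≈⟨ ⊛-assoc (1-q^ m) (countGF m) S ⟩
    1-q^ m ⊛ (countGF m ⊛ S)                                   ∎)
    where
    open ≐-Reasoning
    m = suc b
    ε = + isMarked m
    S = lambertSum b ⊕ (if marked m then lambertTerm m else 𝟘)
    scaled : mono m ⊛ (ε ·ˢ countGF m) ≐ countGF b ⊛ (ε ·ˢ lambertTerm m)
    scaled n = trans (⊛-scaleʳ ε (mono m) (countGF m) n)
      (trans (cong (ε *_) (≐-sym (countGF⊛lambertTerm b allowed-b) n)) (sym (⊛-scaleʳ ε (countGF b) (lambertTerm m) n)))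
    marked-term : (if marked m then lambertTerm m else 𝟘) ≐ ε ·ˢ lambertTerm m
    marked-term n with marked m
    ... | true  = sym (ℤP.*-identityˡ (lambertTerm m n))
    ... | false = refl

  eulerProduct-stable : Stabilizes eulerProduct
  eulerProduct-stable b j j≤b = ⊛-1-q^-< (suc b) (eulerProduct b) (s≤s j≤b)

  excludedProduct-stable : Stabilizes excludedProduct
  excludedProduct-stable b j j≤b with allowed (suc b)
  ... | true  = ⊛-identityʳ (excludedProduct b) j
  ... | false = ⊛-1-q^-< (suc b) (excludedProduct b) (s≤s j≤b)

  lambertSum-stable : Stabilizes lambertSum
  lambertSum-stable b j j≤b with allowed (suc b) ∧ marked (suc b)
  ... | true  = trans (cong (_+_ (lambertSum b j)) (lambertTerm-< (suc b) j (s≤s j≤b))) (ℤP.+-identityʳ _)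
  ... | false = ℤP.+-identityʳ _

  eulerProduct-const : ∀ b → eulerProduct b 0 ≡ + 1
  eulerProduct-const zero = refl
  eulerProduct-const (suc b) rewrite eulerProduct-const b = refl

  countGF≐excludedProduct⊛inv : ∀ b → countGF b ≐ excludedProduct b ⊛ inv (eulerProduct b)
  countGF≐excludedProduct⊛inv b = ⊛-cancelˡ (eulerProduct b) (eulerProduct-const b) (begin
    eulerProduct b ⊛ countGF b                                ≈⟨ eulerProduct⊛countGF b ⟩
    excludedProduct b                                         ≈⟨ ⊛-identityʳ (excludedProduct b) ⟨
    excludedProduct b ⊛ one                                   ≈⟨ ⊛-congˡ (excludedProduct b) (⊛-inverseʳ (eulerProduct b) (eulerProduct-const b)) ⟨
    excludedProduct b ⊛ (eulerProduct b ⊛ inv (eulerProduct b)) ≈⟨ x∙yz≈y∙xz (excludedProduct b) (eulerProduct b) (inv (eulerProduct b)) ⟩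
    eulerProduct b ⊛ (excludedProduct b ⊛ inv (eulerProduct b)) ∎)
    where open ≐-Reasoning

  lambertSum-Σ≤ : ∀ b n → lambertSum b n ≡ Σ≤ b (summand (λ m → allowed m ∧ marked m) lambertTerm n)
  lambertSum-Σ≤ zero n with allowed 0 ∧ marked 0
  ... | true  = refl
  ... | false = refl
  lambertSum-Σ≤ (suc b) n = trans (cong₂ _+_ (lambertSum-Σ≤ b n) new-term) (sym (Σ≤-snoc b (summand (λ m → allowed m ∧ marked m) lambertTerm n)))
    where
    new-term : (if allowed (suc b) ∧ marked (suc b) then lambertTerm (suc b) else 𝟘) n
             ≡ (if allowed (suc b) ∧ marked (suc b) then lambertTerm (suc b) n else + 0)
    new-term with allowed (suc b) ∧ marked (suc b)
    ... | true  = refl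
    ... | false = refl

  lambertSum≈sumOver : ∀ b → lambertSum b ≈[ b ] sumOver (λ m → allowed m ∧ marked m) lambertTerm
  lambertSum≈sumOver b j j≤b = trans (stable-coeff lambertSum-stable j≤b ℕP.≤-refl) (lambertSum-Σ≤ j j)

  excludedProduct-allowed : ∀ b → allowed (suc b) ≡ true → excludedProduct (suc b) ≐ excludedProduct b
  excludedProduct-allowed b allowed-b rewrite allowed-b = ⊛-identityʳ (excludedProduct b)

  excludedProduct-excluded : ∀ b → allowed (suc b) ≡ false → excludedProduct (suc b) ≐ excludedProduct b ⊛ 1-q^ (suc b)
  excludedProduct-excluded b excluded-b rewrite excluded-b = ≐-refl

  excludedProduct-run : ∀ a e → (∀ i → 0 < i → i ≤ e → allowed (a ℕ.+ i) ≡ true) → excludedProduct (a ℕ.+ e) ≐ excludedProduct a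
  excludedProduct-run a zero    _           = ≐-reflexive (cong excludedProduct (ℕP.+-identityʳ a))
  excludedProduct-run a (suc e) all-allowed = begin
    excludedProduct (a ℕ.+ suc e)   ≡⟨ cong excludedProduct (ℕP.+-suc a e) ⟩
    excludedProduct (suc (a ℕ.+ e)) ≈⟨ excludedProduct-allowed (a ℕ.+ e) last-allowed ⟩
    excludedProduct (a ℕ.+ e)       ≈⟨ excludedProduct-run a e (λ i 0<i i≤e → all-allowed i 0<i (ℕP.m≤n⇒m≤1+n i≤e)) ⟩
    excludedProduct a               ∎
    where
    open ≐-Reasoning
    last-allowed : allowed (suc (a ℕ.+ e)) ≡ true
    last-allowed = subst (λ m → allowed m ≡ true) (ℕP.+-suc a e) (all-allowed (suc e) (s≤s z≤n) ℕP.≤-refl)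

  pochFin-1≐eulerProduct : ∀ N → pochFin 1 1 N ≐ eulerProduct (suc N)
  pochFin-1≐eulerProduct zero    = ≐-sym (⊛-identityˡ (1-q^ 1))
  pochFin-1≐eulerProduct (suc N) = ⊛-cong (pochFin-1≐eulerProduct N) (≐-reflexive (cong 1-q^ (cong suc (ℕP.+-identityʳ (suc N)))))

  eulerProduct≈poch : ∀ n → eulerProduct n ≈[ n ] poch 1 1
  eulerProduct≈poch n j j≤n = trans (stable-coeff eulerProduct-stable j≤n (ℕP.n≤1+n j)) (sym (pochFin-1≐eulerProduct j j))

  markedGF-diagonal : ∀ n → markedGF n n ≡ (excludedProduct n ⊛ inv (eulerProduct n) ⊛ sumOver (λ m → allowed m ∧ marked m) lambertTerm) n
  markedGF-diagonal n = trans (markedGF≐countGF⊛lambertSum n n)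
    (⊛-coeff-cong n (≐⇒≈ n (countGF≐excludedProduct⊛inv n)) (lambertSum≈sumOver n))

module IndivisiblePartitions (k-1 r t-1 : ℕ) where
  open PowerSeries
  open import Data.Nat using (zero; suc; _+_; _*_; _≤_; _<_; s≤s)
  import Data.Nat.Properties as ℕP
  open import Data.Nat.Divisibility using (_∣?_; m∣m*n)
  open import Data.Bool using (not; _∧_)
  open import Data.Integer using (_-_)
  open import Data.Nat.Coprimality using (Coprime)
  open Arithmetic using (¬∣-between; ≡ᵇ-mod-*-inverse)
  open import Relation.Binary.PropositionalEquality
  open import Relation.Nullary using (does)
  open import Relation.Nullary.Decidable using (dec-true; dec-false)

  k t : ℕ
  k = suc k-1
  t = suc t-1

  open PartitionSeries (indivPart k) (λ p → p ≡ᵇ r [mod t ]) public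

  indivPart-between : ∀ M i → 0 < i → i ≤ k-1 → indivPart k (k * M + i) ≡ true
  indivPart-between M i 0<i i≤k-1 = cong not (dec-false (k ∣? (k * M + i)) (¬∣-between k M i 0<i (s≤s i≤k-1)))

  indivPart-multiple : ∀ M → indivPart k (k * suc M) ≡ false
  indivPart-multiple M = cong not (dec-true (k ∣? (k * suc M)) (m∣m*n (suc M)))

  excludedProduct-block : ∀ M → excludedProduct (k * suc M) ≐ excludedProduct (k * M) ⊛ 1-q^ (k * suc M)
  excludedProduct-block M = begin
    excludedProduct (k * suc M)                        ≡⟨ cong excludedProduct k[1+M]≡1+last ⟩
    excludedProduct (suc last)                         ≈⟨ excludedProduct-excluded last last-excluded ⟩
    excludedProduct last ⊛ 1-q^ (suc last)             ≈⟨ ⊛-cong (excludedProduct-run (k * M) k-1 (indivPart-between M))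
                                                                  (≐-reflexive (cong 1-q^ (sym k[1+M]≡1+last))) ⟩
    excludedProduct (k * M) ⊛ 1-q^ (k * suc M)         ∎
    where
    open ≐-Reasoning
    last = k * M + k-1
    k[1+M]≡1+last : k * suc M ≡ suc last
    k[1+M]≡1+last = trans (ℕP.*-suc k M) (trans (ℕP.+-comm k (k * M)) (ℕP.+-suc (k * M) k-1))
    last-excluded : indivPart k (suc last) ≡ false
    last-excluded = subst (λ m → indivPart k m ≡ false) k[1+M]≡1+last (indivPart-multiple M)

  pochFin-k≐excludedProduct : ∀ N → pochFin k k N ≐ excludedProduct (k * suc N)
  pochFin-k≐excludedProduct zero = begin
    1-q^ k                                  ≡⟨ cong 1-q^ (ℕP.*-identityʳ k) ⟨
    1-q^ (k * 1)                            ≈⟨ ⊛-identityˡ (1-q^ (k * 1)) ⟨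
    one ⊛ 1-q^ (k * 1)                      ≡⟨ cong (λ m → excludedProduct m ⊛ 1-q^ (k * 1)) (ℕP.*-zeroʳ k) ⟨
    excludedProduct (k * 0) ⊛ 1-q^ (k * 1)  ≈⟨ excludedProduct-block 0 ⟨
    excludedProduct (k * 1)                 ∎
    where open ≐-Reasoning
  pochFin-k≐excludedProduct (suc N) = begin
    pochFin k k N ⊛ 1-q^ (k + k * suc N)              ≈⟨ ⊛-cong (pochFin-k≐excludedProduct N) (≐-reflexive (cong 1-q^ (sym (ℕP.*-suc k (suc N))))) ⟩
    excludedProduct (k * suc N) ⊛ 1-q^ (k * suc (suc N)) ≈⟨ excludedProduct-block (suc N) ⟨
    excludedProduct (k * suc (suc N))                 ∎
    where open ≐-Reasoning

  excludedProduct≈poch : ∀ n → excludedProduct n ≈[ n ] poch k k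
  excludedProduct≈poch n j j≤n = trans (stable-coeff excludedProduct-stable j≤n (ℕP.≤-trans (ℕP.n≤1+n j) (ℕP.m≤n*m (suc j) k)))
    (sym (pochFin-k≐excludedProduct j j))

  lambertSeries : FPS
  lambertSeries = sumOver (λ m → indivPart k m ∧ (m ≡ᵇ r [mod t ])) lambertTerm

  D×-generatingFunction : ∀ n → Dgen k r t n ≡ (poch k k ⊛ inv (poch 1 1) ⊛ lambertSeries) n
  D×-generatingFunction n = trans (markedGF-diagonal n)
    (⊛-coeff-cong n {g = lambertSeries} (⊛-cong-≈ (excludedProduct≈poch n) (inv-cong-≈ n (eulerProduct≈poch n))) (λ _ _ → refl))

  lambertSeries-coprime : ∀ rbar → Coprime t k → ((rbar * k) ≡ᵇ r [mod t ]) ≡ true →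
    lambertSeries ≐ sumOver (λ m → m ≡ᵇ r [mod t ]) lambertTerm ⊖ sumOver (λ m → m ≡ᵇ rbar [mod t ]) (λ m → lambertTerm (m * k))
  lambertSeries-coprime rbar coprime rbar-inverse = begin
    sumOver (λ m → not (k∣ m) ∧ ≡r m) lambertTerm
      ≈⟨ sumOver-not-∧ k∣_ ≡r lambertTerm ⟩
    sumOver ≡r lambertTerm ⊖ sumOver (λ m → k∣ m ∧ ≡r m) lambertTerm
      ≈⟨ ⊖-congˡ (sumOver ≡r lambertTerm) (sumOver-multiples k-1 ≡r lambertTerm lambertTerm-<) ⟩
    sumOver ≡r lambertTerm ⊖ sumOver (λ j → ≡r (j * k)) (λ j → lambertTerm (j * k))
      ≈⟨ ⊖-congˡ (sumOver ≡r lambertTerm) (sumOver-cong (λ j → lambertTerm (j * k)) (≡ᵇ-mod-*-inverse {r = r} {s = rbar} coprime rbar-inverse)) ⟩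
    sumOver ≡r lambertTerm ⊖ sumOver (λ j → j ≡ᵇ rbar [mod t ]) (λ j → lambertTerm (j * k))
      ∎
    where
    open ≐-Reasoning
    k∣_ ≡r : ℕ → Bool
    k∣ m = does (k ∣? m)
    ≡r m = m ≡ᵇ r [mod t ]
    ⊖-congˡ : ∀ f {g g'} → g ≐ g' → f ⊖ g ≐ f ⊖ g'
    ⊖-congˡ f g≐g' n = cong (f n -_) (g≐g' n)

  D×-generatingFunction-coprime : ∀ rbar → Coprime t k → ((rbar * k) ≡ᵇ r [mod t ]) ≡ true → ∀ n →
    Dgen k r t n ≡ (poch k k ⊛ inv (poch 1 1) ⊛ (sumOver (λ m → m ≡ᵇ r [mod t ]) lambertTerm
                                                ⊖ sumOver (λ m → m ≡ᵇ rbar [mod t ]) (λ m → lambertTerm (m * k)))) n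
  D×-generatingFunction-coprime rbar coprime rbar-inverse n = trans (D×-generatingFunction n)
    (⊛-coeff-cong n {poch k k ⊛ inv (poch 1 1)} (λ _ _ → refl) (≐⇒≈ n (lambertSeries-coprime rbar coprime rbar-inverse)))

open import Data.Nat using (_≤_; _*_; s≤s)
open import Data.Nat.GCD using (gcd)
open import Data.Nat.Coprimality using (gcd≡1⇒coprime) renaming (sym to coprime-sym)
open import Data.Bool using (not; _∧_)
open import Data.Product using (_×_; _,_)
open import Relation.Binary.PropositionalEquality using (_≡_)
open import Relation.Nullary using (does)
open import Data.Nat.Divisibility using (_∣?_)

lemma3p1 : (k t r : ℕ) → 2 ≤ k → 2 ≤ t → 1 ≤ r → r ≤ t →
    ((n : ℕ) → Dgen k r t n ≡ (poch k k ⊛ inv (poch 1 1) ⊛ sumOver (λ m → not (does (k ∣? m)) ∧ (m ≡ᵇ r [mod t ])) lambertTerm) n)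
    × (gcd k t ≡ 1 → (rbar : ℕ) → 1 ≤ rbar → rbar ≤ t → (rbar * k) ≡ᵇ r [mod t ] ≡ true →
        (n : ℕ) → Dgen k r t n ≡ (poch k k ⊛ inv (poch 1 1) ⊛ (sumOver (λ m → m ≡ᵇ r [mod t ]) lambertTerm ⊖ sumOver (λ m → m ≡ᵇ rbar [mod t ]) (λ m → lambertTerm (m * k)))) n)
lemma3p1 (suc k-1) (suc t-1) r (s≤s _) (s≤s _) _ _ =
  D×-generatingFunction ,
  λ gcd≡1 rbar _ _ → D×-generatingFunction-coprime rbar (coprime-sym (gcd≡1⇒coprime gcd≡1))
  where open IndivisiblePartitions k-1 r t-1
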